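{- Fix a nonnegative integer $j$. For every integer $k\ge 3$, every odd positive integer $m$ such that the $j$-fix of $\mathbf{t}$ of length $km$ is not a $k$-anti-power satisfies $m\le 3k-4$; that is, $\Gamma_j(k)\le 3k-4$. Moreover, $$\limsup_{k\to\infty}\frac{\Gamma_j(k)}{k}=3.$$
   Context: The Thue–Morse word $\mathbf{t}=\mathbf{t}_1\mathbf{t}_2\mathbf{t}_3\cdots=0110100110010110\cdots$ is the infinite binary word whose $i$-th letter $\mathbf{t}_i$ ($i\ge 1$) is the parity of the number of 1's in the binary expansion of $i-1$. A $k$-anti-power is a word $w^{(1)}\cdots w^{(k)}$ with $w^{(1)},\dots,w^{(k)}$ pairwise distinct words of the same length. For $j\ge0$, the $j$-fix of $\mathbf{t}$ of length $N$ is $\mathbf{t}_{j+1}\cdots\mathbf{t}_{j+N}$. $\mathcal{F}_j(k)$ is the set of odd positive integers $m$ such that the $j$-fix of $\mathbf{t}$ of length $km$ is a $k$-anti-power, and $\Gamma_j(k)=\sup\big((2\mathbb{Z}^+-1)\setminus\mathcal{F}_j(k)\big)$; for all sufficiently large $k$ this is a well-defined odd positive integer. -}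

module Defs where

open import Data.Bool using (Bool; true; false; not; _xor_)
open import Data.Nat using (ℕ; zero; suc; _+_; _*_; _∸_; _≤_; _<_; _≡ᵇ_)
open import Data.Nat.DivMod using (_/_; _%_)
open import Data.List using (List; map; upTo; take; drop; length)
open import Data.Product using (_×_; ∃-syntax)
open import Relation.Binary.PropositionalEquality using (_≡_; _≢_)
open import Relation.Nullary using (¬_)

-- Parity of the number of 1's in the binary expansion of n, computed with
-- fuel (fuel ≥ n is always enough, since halving reaches 0 within n steps).
parityOnesFuel : ℕ → ℕ → Bool
parityOnesFuel zero    n = false
parityOnesFuel (suc f) n = (n % 2 ≡ᵇ 1) xor parityOnesFuel f (n / 2)

parityOnes : ℕ → Bool
parityOnes n = parityOnesFuel n n

-- Thue–Morse word, 0-indexed: tm i = 𝐭_{i+1} = parity of ones of i.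
-- (false = letter 0, true = letter 1.)
tm : ℕ → Bool
tm i = parityOnes i

-- j-fix of 𝐭 of length N : 𝐭_{j+1} ⋯ 𝐭_{j+N}.
jFix : ℕ → ℕ → List Bool
jFix j N = map (λ i → tm (j + i)) (upTo N)

IsAntiPower : ℕ → ℕ → List Bool → Set
IsAntiPower k m w =
  length w ≡ k * m ×
  (∀ a b → a < k → b < k → a ≢ b →
     take m (drop (a * m) w) ≢ take m (drop (b * m) w))

Odd : ℕ → Set
Odd m = ∃[ r ] m ≡ suc (r * 2)

NotInF : ℕ → ℕ → ℕ → Set
NotInF j k m = Odd m × ¬ IsAntiPower k m (jFix j (k * m))

-- g = Γ_j(k) = sup((2ℤ⁺ - 1) ∖ 𝓕_j(k)), i.e. g is the maximum of that set.
IsGamma : ℕ → ℕ → ℕ → Set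
IsGamma j k g = NotInF j k g × (∀ m → NotInF j k m → m ≤ g)

module Submission where

-- Everything rests on the recurrences t(2q) = t(q), t(2q+1) = ¬t(q) and their
-- consequence t(2^h·q + y) = t(q) ⊕ t(y) for y < 2^h.  Say that the factors at
-- i and i' agree on L letters if t(i+r) = t(i'+r) for all r < L.
--
-- Factors at positions of different parity never agree on 4
-- letters (that would put 000 or 111 into t).  Halving both positions halves an
-- even shift, so by well-founded induction on c the factors at i and i + c·m
-- (m odd, c ≥ 1) never agree on 3c + 1 letters.  For odd m > 3k − 4, blocks
-- a < b < k of the j-fix of length km are factors at distance (b − a)·m that
-- would agree on m ≥ 3(b − a) letters; so that j-fix is a k-anti-power.
--
-- With A = 2^s (s even), B = 2^(Q+1), p = 3A − 1, m = Bp + 11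
-- and k = A + AB + 1, the factors at p and p + m agree on 3 letters; scaling by
-- 2^h = AB makes blocks A and A + AB of the j-fix of length km equal, so
-- Γ_j(k) ≥ m, while m/k → 3 as A and B grow.  Γ_j(k) exists as a maximum since
-- non-membership in 𝓕_j(k) is decidable and bounded by the upper bound.

open import Defs
open import Data.Bool using (Bool; true; false; not; _xor_)
open import Data.Bool.Properties using (not-¬; not-involutive; not-injective; not-distribʳ-xor; xor-identityʳ)
import Data.Bool.Properties as Bool
open import Data.Empty using (⊥; ⊥-elim)
open import Data.List using (List; _∷_; applyUpTo; upTo; take; drop; length)
open import Data.List.Properties using (map-upTo; length-map; length-upTo; ∷-injectiveˡ; ∷-injectiveʳ; ≡-dec)
open import Data.Nat
open import Data.Nat.DivMod using (_/_; _%_; m/n<m; m*n%n≡0; m*n/n≡m; [m+kn]%n≡m%n; +-distrib-/)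
open import Data.Nat.Induction using (<-wellFounded)
open import Data.Nat.Properties
open import Data.Nat.Tactic.RingSolver using (solve-∀)
open import Data.Product using (_×_; _,_; proj₁; proj₂; ∃-syntax)
open import Data.Sum using (inj₁; inj₂)
open import Induction.WellFounded using (Acc; acc)
open import Relation.Binary using (tri<; tri≈; tri>)
open import Relation.Binary.PropositionalEquality
open import Relation.Nullary using (¬_; Dec; yes; no)
open import Relation.Nullary.Decidable using (map′; ¬?; _×-dec_; _→-dec_)

-- A slack witness proves an inequality; paired with a ring identity it
-- discharges the arithmetic side conditions below.
≤-slack : ∀ a c {b} → a + c ≡ b → a ≤ b
≤-slack a c refl = m≤m+n a c

data ParityView : ℕ → Set where
  even : ∀ q → ParityView (q * 2)
  odd  : ∀ q → ParityView (suc (q * 2))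

parityView : ∀ n → ParityView n
parityView zero = even 0
parityView (suc n) with parityView n
... | even q = odd q
... | odd q  = even (suc q)

odd≢even : ∀ x y → suc (x * 2) ≢ y * 2
odd≢even zero    zero    ()
odd≢even (suc x) (suc y) eq = odd≢even x y (suc-injective (suc-injective eq))

-- The Thue–Morse recurrences.  `tm` is computed with fuel, so we first show
-- that any sufficient amount of fuel gives the same value.

parityOnesFuel-0 : ∀ f → parityOnesFuel f 0 ≡ false
parityOnesFuel-0 zero    = refl
parityOnesFuel-0 (suc f) = parityOnesFuel-0 f

half≤ : ∀ n f → n ≤ suc f → n / 2 ≤ f
half≤ zero    f _  = z≤n
half≤ (suc n) f le = <⇒≤pred (≤-trans (m/n<m (suc n) 2 (s≤s (s≤s z≤n))) le)

parityOnesFuel-stable : ∀ f g n → n ≤ f → n ≤ g → parityOnesFuel f n ≡ parityOnesFuel g n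
parityOnesFuel-stable zero    zero    n  _   _   = refl
parityOnesFuel-stable zero    (suc g) .0 z≤n _   = sym (parityOnesFuel-0 (suc g))
parityOnesFuel-stable (suc f) zero    .0 _   z≤n = parityOnesFuel-0 (suc f)
parityOnesFuel-stable (suc f) (suc g) n  p   q   =
  cong ((n % 2 ≡ᵇ 1) xor_) (parityOnesFuel-stable f g (n / 2) (half≤ n f p) (half≤ n g q))

tm-double : ∀ q → tm (q * 2) ≡ tm q
tm-double zero    = refl
tm-double (suc q) = begin
  ((suc q * 2) % 2 ≡ᵇ 1) xor parityOnesFuel (suc (q * 2)) (suc q * 2 / 2)
    ≡⟨ cong₂ (λ a b → (a ≡ᵇ 1) xor parityOnesFuel (suc (q * 2)) b) (m*n%n≡0 (suc q) 2) (m*n/n≡m (suc q) 2) ⟩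
  parityOnesFuel (suc (q * 2)) (suc q)
    ≡⟨ parityOnesFuel-stable (suc (q * 2)) (suc q) (suc q) (s≤s (m≤m*n q 2)) ≤-refl ⟩
  tm (suc q) ∎
  where open ≡-Reasoning

tm-double+1 : ∀ q → tm (suc (q * 2)) ≡ not (tm q)
tm-double+1 q = begin
  (suc (q * 2) % 2 ≡ᵇ 1) xor parityOnesFuel (q * 2) (suc (q * 2) / 2)
    ≡⟨ cong₂ (λ a b → (a ≡ᵇ 1) xor parityOnesFuel (q * 2) b) odd%2 odd/2 ⟩
  not (parityOnesFuel (q * 2) q)
    ≡⟨ cong not (parityOnesFuel-stable (q * 2) q q (m≤m*n q 2) ≤-refl) ⟩
  not (tm q) ∎
  where
  open ≡-Reasoning
  odd%2 : suc (q * 2) % 2 ≡ 1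
  odd%2 = [m+kn]%n≡m%n 1 q 2
  odd/2 : suc (q * 2) / 2 ≡ q
  odd/2 = trans (+-distrib-/ 1 (q * 2) (subst (λ x → 1 + x < 2) (sym (m*n%n≡0 q 2)) ≤-refl))
                (m*n/n≡m q 2)

tm-at-even : ∀ x r → tm (x * 2 + r * 2) ≡ tm (x + r)
tm-at-even x r = trans (cong tm (sym (*-distribʳ-+ 2 x r))) (tm-double (x + r))

tm-at-odd : ∀ x r → tm (x * 2 + suc (r * 2)) ≡ not (tm (x + r))
tm-at-odd x r = trans (cong tm (trans (+-suc (x * 2) (r * 2)) (cong suc (sym (*-distribʳ-+ 2 x r)))))
                      (tm-double+1 (x + r))

halve-< : ∀ y N → y * 2 < 2 * N → y < N
halve-< y N lt = *-cancelʳ-< 2 y N (subst (y * 2 <_) (*-comm 2 N) lt)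

double-position : ∀ P q y → 2 * P * q + y * 2 ≡ (P * q + y) * 2
double-position = solve-∀

doubled< : ∀ {L L'} → L' * 2 ≤ suc L → ∀ r → r < L' → r * 2 < L
doubled< L'≤ r r<L' = ≤-pred (≤-trans (*-monoˡ-≤ 2 r<L') L'≤)

tm-scale : ∀ h q y → y < 2 ^ h → tm (2 ^ h * q + y) ≡ tm q xor tm y
tm-scale zero    q zero    _ = trans (cong tm (trans (+-identityʳ (1 * q)) (+-identityʳ q))) (sym (xor-identityʳ (tm q)))
tm-scale zero    q (suc y) (s≤s ())
tm-scale (suc h) q y y< with parityView y
... | even y' = begin
  tm (2 * 2 ^ h * q + y' * 2)  ≡⟨ cong tm (double-position (2 ^ h) q y') ⟩
  tm ((2 ^ h * q + y') * 2)    ≡⟨ tm-double (2 ^ h * q + y') ⟩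
  tm (2 ^ h * q + y')          ≡⟨ tm-scale h q y' (halve-< y' (2 ^ h) y<) ⟩
  tm q xor tm y'               ≡⟨ cong (tm q xor_) (sym (tm-double y')) ⟩
  tm q xor tm (y' * 2)         ∎
  where open ≡-Reasoning
... | odd y' = begin
  tm (2 * 2 ^ h * q + suc (y' * 2))  ≡⟨ cong tm (trans (+-suc (2 * 2 ^ h * q) (y' * 2)) (cong suc (double-position (2 ^ h) q y'))) ⟩
  tm (suc ((2 ^ h * q + y') * 2))    ≡⟨ tm-double+1 (2 ^ h * q + y') ⟩
  not (tm (2 ^ h * q + y'))          ≡⟨ cong not (tm-scale h q y' (halve-< y' (2 ^ h) (≤-trans (n≤1+n _) y<))) ⟩
  not (tm q xor tm y')               ≡⟨ not-distribʳ-xor (tm q) (tm y') ⟩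
  tm q xor not (tm y')               ≡⟨ cong (tm q xor_) (sym (tm-double+1 y')) ⟩
  tm q xor tm (suc (y' * 2))         ∎
  where open ≡-Reasoning

FactorsAgree : ℕ → ℕ → ℕ → Set
FactorsAgree i i' L = ∀ r → r < L → tm (i + r) ≡ tm (i' + r)

agree-≤ : ∀ {i i' L L'} → L' ≤ L → FactorsAgree i i' L → FactorsAgree i i' L'
agree-≤ L'≤L H r r<L' = H r (≤-trans r<L' L'≤L)

agree-drop : ∀ {i i' L} o M → o + M ≤ L → FactorsAgree i i' L → FactorsAgree (i + o) (i' + o) M
agree-drop {i} {i'} o M o+M≤L H r r<M =
  trans (cong tm (+-assoc i o r))
        (trans (H (o + r) (≤-trans (+-monoʳ-< o r<M) o+M≤L)) (cong tm (sym (+-assoc i' o r))))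

agree-scale : ∀ h p p' n → FactorsAgree p p' n → FactorsAgree (2 ^ h * p) (2 ^ h * p') (n * 2 ^ h)
agree-scale h p p' zero    H x ()
agree-scale h p p' (suc n) H x x< with x <? 2 ^ h
... | yes x<2^h = begin
  tm (2 ^ h * p + x)    ≡⟨ tm-scale h p x x<2^h ⟩
  tm p xor tm x         ≡⟨ cong (_xor tm x) first-letter ⟩
  tm p' xor tm x        ≡⟨ sym (tm-scale h p' x x<2^h) ⟩
  tm (2 ^ h * p' + x)   ∎
  where
  open ≡-Reasoning
  first-letter : tm p ≡ tm p'
  first-letter = subst₂ (λ a b → tm a ≡ tm b) (+-identityʳ p) (+-identityʳ p') (H 0 z<s)
... | no x≮2^h = begin
  tm (2 ^ h * p + x)              ≡⟨ cong tm (next-block p) ⟩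
  tm (2 ^ h * (p + 1) + y)        ≡⟨ agree-scale h (p + 1) (p' + 1) n (agree-drop {p} {p'} 1 n ≤-refl H) y y< ⟩
  tm (2 ^ h * (p' + 1) + y)       ≡⟨ cong tm (sym (next-block p')) ⟩
  tm (2 ^ h * p' + x)             ∎
  where
  open ≡-Reasoning
  y = x ∸ 2 ^ h
  x≡ : 2 ^ h + y ≡ x
  x≡ = m+[n∸m]≡n (≮⇒≥ x≮2^h)
  y< : y < n * 2 ^ h
  y< = +-cancelˡ-< (2 ^ h) y (n * 2 ^ h) (subst (_< 2 ^ h + n * 2 ^ h) (sym x≡) x<)
  shift : ∀ P q y → P * q + (P + y) ≡ P * (q + 1) + y
  shift = solve-∀
  next-block : ∀ q → 2 ^ h * q + x ≡ 2 ^ h * (q + 1) + y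
  next-block q = trans (cong (2 ^ h * q +_) (sym x≡)) (shift (2 ^ h) q y)

-- t contains neither 000 nor 111: an aligned pair t(2x), t(2x+1) always differs.
no-three-equal : ∀ q → tm (q + 0) ≡ tm (q + 1) → tm (q + 1) ≡ tm (q + 2) → ⊥
no-three-equal q e₁ e₂ with parityView q
... | even x = not-¬ refl (trans (sym (tm-at-even x 0)) (trans e₁ (tm-at-odd x 0)))
... | odd x = not-¬ refl (trans (sym (tm-at-even x 1)) (trans e₂' (tm-at-odd x 1)))
  where
  e₂' : tm (x * 2 + 2) ≡ tm (x * 2 + 3)
  e₂' = subst₂ (λ a b → tm a ≡ tm b) (sym (+-suc (x * 2) 1)) (sym (+-suc (x * 2) 2)) e₂

-- Factors at an even and at an odd position never agree on 4 letters:
-- reading both through the recurrences would give t(y) = t(y+1) = t(y+2).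
even-odd-disagree : ∀ x y → ¬ FactorsAgree (x * 2) (suc (y * 2)) 4
even-odd-disagree x y H = no-three-equal y (trans (sym (flip e₀)) e₁) (trans (sym (flip e₂)) e₃)
  where
  letter : ∀ r → r < 4 → ∀ {a b} → tm (x * 2 + r) ≡ a → tm (y * 2 + suc r) ≡ b → a ≡ b
  letter r r<4 p q = trans (sym p) (trans (H r r<4) (trans (cong tm (sym (+-suc (y * 2) r))) q))
  flip : ∀ {a b} → a ≡ not b → not a ≡ b
  flip {b = b} e = trans (cong not e) (not-involutive b)
  e₀ : tm (x + 0) ≡ not (tm (y + 0))
  e₀ = letter 0 (s≤s z≤n) (tm-at-even x 0) (tm-at-odd y 0)
  e₁ : not (tm (x + 0)) ≡ tm (y + 1)
  e₁ = letter 1 (s≤s (s≤s z≤n)) (tm-at-odd x 0) (tm-at-even y 1)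
  e₂ : tm (x + 1) ≡ not (tm (y + 1))
  e₂ = letter 2 (s≤s (s≤s (s≤s z≤n))) (tm-at-even x 1) (tm-at-odd y 1)
  e₃ : not (tm (x + 1)) ≡ tm (y + 2)
  e₃ = letter 3 ≤-refl (tm-at-odd x 1) (tm-at-even y 2)

odd-shift-disagree : ∀ i d → Odd d → ¬ FactorsAgree i (i + d) 4
odd-shift-disagree i .(suc (e * 2)) (e , refl) H with parityView i
... | even x = even-odd-disagree x (x + e) (λ r r<4 → trans (H r r<4) (cong (λ z → tm (z + r)) (even+odd x e)))
  where
  even+odd : ∀ x e → x * 2 + suc (e * 2) ≡ suc ((x + e) * 2)
  even+odd = solve-∀
... | odd x = even-odd-disagree (suc (x + e)) x (λ r r<4 → sym (trans (H r r<4) (cong (λ z → tm (z + r)) (odd+odd x e))))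
  where
  odd+odd : ∀ x e → suc (x * 2) + suc (e * 2) ≡ suc (x + e) * 2
  odd+odd = solve-∀

halve-agreement : ∀ i e L L' → L' * 2 ≤ suc L → FactorsAgree i (i + e * 2) L → ∃[ x ] FactorsAgree x (x + e) L'
halve-agreement i e L L' L'≤ H with parityView i
... | even x = x , λ r r<L' → begin
  tm (x + r)                  ≡⟨ tm-at-even x r ⟨
  tm (x * 2 + r * 2)          ≡⟨ H (r * 2) (doubled< L'≤ r r<L') ⟩
  tm (x * 2 + e * 2 + r * 2)  ≡⟨ cong (λ z → tm (z + r * 2)) (*-distribʳ-+ 2 x e) ⟨
  tm ((x + e) * 2 + r * 2)    ≡⟨ tm-at-even (x + e) r ⟩
  tm (x + e + r)              ∎
  where open ≡-Reasoning
... | odd x = x , λ r r<L' → not-injective (begin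
  not (tm (x + r))                  ≡⟨ tm-double+1 (x + r) ⟨
  tm (suc ((x + r) * 2))            ≡⟨ cong (λ z → tm (suc z)) (*-distribʳ-+ 2 x r) ⟩
  tm (suc (x * 2) + r * 2)          ≡⟨ H (r * 2) (doubled< L'≤ r r<L') ⟩
  tm (suc (x * 2) + e * 2 + r * 2)  ≡⟨ cong tm (odd-position x e r) ⟩
  tm (suc ((x + e + r) * 2))        ≡⟨ tm-double+1 (x + e + r) ⟩
  not (tm (x + e + r))              ∎)
  where
  open ≡-Reasoning
  odd-position : ∀ x e r → suc (x * 2) + e * 2 + r * 2 ≡ suc ((x + e + r) * 2)
  odd-position = solve-∀

odd*odd : ∀ c t → Odd (suc (c * 2) * suc (t * 2))
odd*odd c t = t + c * suc (t * 2) , product c t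
  where
  product : ∀ c t → suc (c * 2) * suc (t * 2) ≡ suc ((t + c * suc (t * 2)) * 2)
  product = solve-∀

-- For odd m and c ≥ 1 the factors at i and i + c·m never agree on
-- 3c + 1 letters: odd c is excluded by `odd-shift-disagree`, and even c = 2c'
-- is halved to c' (well-founded induction on c).
no-long-agreement : ∀ t c → 1 ≤ c → ∀ i → ¬ FactorsAgree i (i + c * suc (t * 2)) (suc (3 * c))
no-long-agreement t c = go c (<-wellFounded c)
  where
  m = suc (t * 2)
  regroup : ∀ c m → c * 2 * m ≡ c * m * 2
  regroup = solve-∀
  halved-length : ∀ c → suc (3 * c) * 2 ≡ suc (suc (3 * (c * 2)))
  halved-length = solve-∀
  go : ∀ c → Acc _<_ c → 1 ≤ c → ∀ i → ¬ FactorsAgree i (i + c * m) (suc (3 * c))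
  go c _ _ i H with parityView c
  go .(suc (c' * 2)) _ _ i H | odd c' =
    odd-shift-disagree i (suc (c' * 2) * m) (odd*odd c' t)
                       (agree-≤ {i} {i + suc (c' * 2) * m} (s≤s (*-monoʳ-≤ 3 (s≤s z≤n))) H)
  go .(zero * 2) _ () i H | even zero
  go .(suc c' * 2) (acc rs) _ i H | even (suc c') with
    halve-agreement i (suc c' * m) (suc (3 * (suc c' * 2))) (suc (3 * suc c')) (≤-reflexive (halved-length (suc c')))
      (subst (λ d → FactorsAgree i (i + d) (suc (3 * (suc c' * 2)))) (regroup (suc c') m) H)
  ... | x , H' = go (suc c') (rs (m<m*n (suc c') 2 ≤-refl)) (s≤s z≤n) x H'

-- The case needed for blocks: factors at distance c·m (m odd, m ≥ 4,
-- 3c ≤ m) never agree on m letters.  For even c, 3c ≤ m forces 3c < m.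
no-block-agreement : ∀ t c i → 1 ≤ c → 3 * c ≤ suc (t * 2) → 4 ≤ suc (t * 2) →
  ¬ FactorsAgree i (i + c * suc (t * 2)) (suc (t * 2))
no-block-agreement t c i 1≤c 3c≤m 4≤m H with parityView c
... | odd c'  = odd-shift-disagree i _ (odd*odd c' t) (agree-≤ {i} {i + c * suc (t * 2)} 4≤m H)
... | even c' = no-long-agreement t (c' * 2) 1≤c i (agree-≤ {i} {i + c * suc (t * 2)} 3c<m H)
  where
  triple : ∀ c → 3 * (c * 2) ≡ 3 * c * 2
  triple = solve-∀
  3c<m : 3 * (c' * 2) < suc (t * 2)
  3c<m = ≤∧≢⇒< 3c≤m (λ e → odd≢even t (3 * c') (trans (sym e) (triple c')))

drop-applyUpTo : ∀ {A : Set} (f : ℕ → A) s n → drop s (applyUpTo f (s + n)) ≡ applyUpTo (λ r → f (s + r)) n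
drop-applyUpTo f zero    n = refl
drop-applyUpTo f (suc s) n = drop-applyUpTo (λ r → f (suc r)) s n

take-applyUpTo : ∀ {A : Set} (f : ℕ → A) m n → take m (applyUpTo f (m + n)) ≡ applyUpTo f m
take-applyUpTo f zero    n = refl
take-applyUpTo f (suc m) n = cong (f 0 ∷_) (take-applyUpTo (λ r → f (suc r)) m n)

applyUpTo-cong : ∀ {A : Set} (f g : ℕ → A) n → (∀ r → r < n → f r ≡ g r) → applyUpTo f n ≡ applyUpTo g n
applyUpTo-cong f g zero    H = refl
applyUpTo-cong f g (suc n) H =
  cong₂ _∷_ (H 0 z<s) (applyUpTo-cong (λ r → f (suc r)) (λ r → g (suc r)) n (λ r r<n → H (suc r) (s≤s r<n)))

applyUpTo-injective : ∀ {A : Set} (f g : ℕ → A) n → applyUpTo f n ≡ applyUpTo g n → ∀ r → r < n → f r ≡ g r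
applyUpTo-injective f g (suc n) eq zero    _         = ∷-injectiveˡ eq
applyUpTo-injective f g (suc n) eq (suc r) (s≤s r<n) =
  applyUpTo-injective (λ r → f (suc r)) (λ r → g (suc r)) n (∷-injectiveʳ eq) r r<n

factor : ℕ → ℕ → List Bool
factor i L = applyUpTo (λ r → tm (i + r)) L

factor-≡⇒agree : ∀ i i' L → factor i L ≡ factor i' L → FactorsAgree i i' L
factor-≡⇒agree i i' L = applyUpTo-injective (λ r → tm (i + r)) (λ r → tm (i' + r)) L

agree⇒factor-≡ : ∀ i i' L → FactorsAgree i i' L → factor i L ≡ factor i' L
agree⇒factor-≡ i i' L = applyUpTo-cong (λ r → tm (i + r)) (λ r → tm (i' + r)) L

jFix-block : ∀ j k m a → a < k → take m (drop (a * m) (jFix j (k * m))) ≡ factor (j + a * m) m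
jFix-block j k m a a<k = begin
  take m (drop (a * m) (jFix j (k * m)))
    ≡⟨ cong (λ w → take m (drop (a * m) w)) (map-upTo (λ i → tm (j + i)) (k * m)) ⟩
  take m (drop (a * m) (applyUpTo (λ i → tm (j + i)) (k * m)))
    ≡⟨ cong (λ n → take m (drop (a * m) (applyUpTo (λ i → tm (j + i)) n))) k*m≡ ⟩
  take m (drop (a * m) (applyUpTo (λ i → tm (j + i)) (a * m + (m + d * m))))
    ≡⟨ cong (take m) (drop-applyUpTo (λ i → tm (j + i)) (a * m) (m + d * m)) ⟩
  take m (applyUpTo (λ r → tm (j + (a * m + r))) (m + d * m))
    ≡⟨ take-applyUpTo (λ r → tm (j + (a * m + r))) m (d * m) ⟩
  applyUpTo (λ r → tm (j + (a * m + r))) m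
    ≡⟨ applyUpTo-cong (λ r → tm (j + (a * m + r))) (λ r → tm (j + a * m + r)) m (λ r _ → cong tm (sym (+-assoc j (a * m) r))) ⟩
  factor (j + a * m) m ∎
  where
  open ≡-Reasoning
  d = k ∸ suc a
  split : ∀ a d m → suc (a + d) * m ≡ a * m + (m + d * m)
  split = solve-∀
  k*m≡ : k * m ≡ a * m + (m + d * m)
  k*m≡ = trans (cong (_* m) (sym (m+[n∸m]≡n a<k))) (split a d m)

-- Upper bound.  For odd m > 3k − 4 (k ≥ 3) two blocks a < b < k would be
-- factors at distance (b − a)·m with 3(b − a) ≤ m agreeing on m letters.
long-blocks-distinct : ∀ j k t a b → 3 ≤ k → 3 * k ∸ 4 < suc (t * 2) → a < b → b < k →
  factor (j + a * suc (t * 2)) (suc (t * 2)) ≢ factor (j + b * suc (t * 2)) (suc (t * 2))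
long-blocks-distinct j k t a b 3≤k big a<b b<k eq =
  no-block-agreement t c (j + a * m) (m<n⇒0<n∸m a<b) 3c≤m 4≤m
    (subst (λ z → FactorsAgree (j + a * m) z m) b-position
           (factor-≡⇒agree (j + a * m) (j + b * m) m eq))
  where
  m = suc (t * 2)
  c = b ∸ a
  shift : ∀ j a c m → j + (a + c) * m ≡ j + a * m + c * m
  shift = solve-∀
  b-position : j + b * m ≡ j + a * m + c * m
  b-position = trans (cong (λ z → j + z * m) (sym (m+[n∸m]≡n (<⇒≤ a<b)))) (shift j a c m)
  3k≤3+m : 3 * k ≤ 3 + m
  3k≤3+m = ≤-trans (m≤n+m∸n (3 * k) 4) (+-monoʳ-≤ 3 big)
  3c≤m : 3 * c ≤ m
  3c≤m = +-cancelˡ-≤ 3 (3 * c) m (begin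
    3 + 3 * c   ≡⟨ *-suc 3 c ⟨
    3 * suc c   ≤⟨ *-monoʳ-≤ 3 (≤-<-trans (m∸n≤m b a) b<k) ⟩
    3 * k       ≤⟨ 3k≤3+m ⟩
    3 + m       ∎)
    where open ≤-Reasoning
  4≤m : 4 ≤ m
  4≤m = ≤-trans (n≤1+n 4) (≤-trans (n≤1+n 5) (+-cancelˡ-≤ 3 6 m (≤-trans (*-monoʳ-≤ 3 3≤k) 3k≤3+m)))

long-blocks-antiPower : ∀ j k t → 3 ≤ k → 3 * k ∸ 4 < suc (t * 2) →
  IsAntiPower k (suc (t * 2)) (jFix j (k * suc (t * 2)))
long-blocks-antiPower j k t 3≤k big = length≡ , blocks-differ
  where
  m = suc (t * 2)
  length≡ : length (jFix j (k * m)) ≡ k * m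
  length≡ = trans (length-map _ (upTo (k * m))) (length-upTo (k * m))
  block : ∀ a → a < k → take m (drop (a * m) (jFix j (k * m))) ≡ factor (j + a * m) m
  block a = jFix-block j k m a
  blocks-differ : ∀ a b → a < k → b < k → a ≢ b →
    take m (drop (a * m) (jFix j (k * m))) ≢ take m (drop (b * m) (jFix j (k * m)))
  blocks-differ a b a<k b<k a≢b eq with <-cmp a b
  ... | tri< a<b _ _ = long-blocks-distinct j k t a b 3≤k big a<b b<k
                         (trans (sym (block a a<k)) (trans eq (block b b<k)))
  ... | tri≈ _ a≡b _ = a≢b a≡b
  ... | tri> _ _ b<a = long-blocks-distinct j k t b a 3≤k big b<a a<k
                         (trans (sym (block b b<k)) (trans (sym eq) (block a a<k)))

antiPower-bound : ∀ j k → k ≥ 3 → (m : ℕ) → NotInF j k m → m ≤ 3 * k ∸ 4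
antiPower-bound j k 3≤k m ((t , refl) , not-antiPower) with m ≤? 3 * k ∸ 4
... | yes m≤ = m≤
... | no  m≰ = ⊥-elim (not-antiPower (long-blocks-antiPower j k t 3≤k (≰⇒> m≰)))

-- Decidability of non-membership in 𝓕_j(k), needed to take the maximum Γ_j(k).
odd? : ∀ m → Dec (Odd m)
odd? m with parityView m
... | even q = no (λ (r , e) → odd≢even r q (sym e))
... | odd q  = yes (q , refl)

antiPower? : ∀ k m w → Dec (IsAntiPower k m w)
antiPower? k m w = (length w ≟ k * m) ×-dec
  map′ (λ f a b a<k b<k → f a<k b<k) (λ f {a} a<k {b} b<k → f a b a<k b<k)
       (allUpTo? (λ a → allUpTo? (λ b → ¬? (a ≟ b) →-dec ¬? (≡-dec Bool._≟_ (block a) (block b))) k) k)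
  where
  block : ℕ → List Bool
  block a = take m (drop (a * m) w)

notInF? : ∀ j k m → Dec (NotInF j k m)
notInF? j k m = odd? m ×-dec ¬? (antiPower? k m (jFix j (k * m)))

bounded-maximum : {P : ℕ → Set} → (∀ n → Dec (P n)) → ∀ B → (∀ x → P x → x ≤ B) →
  ∀ m₀ → P m₀ → ∃[ g ] (P g × (∀ x → P x → x ≤ g))
bounded-maximum P? B bound m₀ p₀ with P? B
... | yes pB = B , pB , bound
bounded-maximum P? zero    bound m₀ p₀ | no ¬pB with bound m₀ p₀
... | z≤n = ⊥-elim (¬pB p₀)
bounded-maximum {P} P? (suc B) bound m₀ p₀ | no ¬pB = bounded-maximum P? B bound' m₀ p₀
  where
  bound' : ∀ x → P x → x ≤ B
  bound' x px with m≤n⇒m<n∨m≡n (bound x px)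
  ... | inj₁ x<1+B = ≤-pred x<1+B
  ... | inj₂ refl  = ⊥-elim (¬pB px)

gamma-exists : ∀ j k → k ≥ 3 → ∀ m → NotInF j k m → ∃[ g ] (IsGamma j k g × m ≤ g)
gamma-exists j k 3≤k m m∉F with bounded-maximum (notInF? j k) (3 * k ∸ 4) (antiPower-bound j k 3≤k) m m∉F
... | g , g∉F , maximal = g , (g∉F , maximal) , maximal m m∉F

allOnes : ℕ → ℕ
allOnes zero    = 0
allOnes (suc s) = suc (allOnes s * 2)

suc-allOnes : ∀ s → suc (allOnes s) ≡ 2 ^ s
suc-allOnes zero    = refl
suc-allOnes (suc s) = trans (cong (_* 2) (suc-allOnes s)) (*-comm (2 ^ s) 2)

tm-allOnes-even : ∀ σ → tm (allOnes (σ * 2)) ≡ false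
tm-allOnes-even zero    = refl
tm-allOnes-even (suc σ) = begin
  tm (suc (allOnes (suc (σ * 2)) * 2))  ≡⟨ tm-double+1 (allOnes (suc (σ * 2))) ⟩
  not (tm (suc (allOnes (σ * 2) * 2)))  ≡⟨ cong not (tm-double+1 (allOnes (σ * 2))) ⟩
  not (not (tm (allOnes (σ * 2))))      ≡⟨ cong (λ b → not (not b)) (tm-allOnes-even σ) ⟩
  false                                 ∎
  where open ≡-Reasoning

n<2^n : ∀ n → n < 2 ^ n
n<2^n zero    = z<s
n<2^n (suc n) = ≤-trans (+-mono-≤ (m^n>0 2 n) (n<2^n n)) (≤-reflexive (cong (2 ^ n +_) (sym (+-identityʳ (2 ^ n)))))

-- With A = 2^s (s = 2σ),
-- B = 2^(Q+1), p = 3A − 1, m = B·p + 11 (odd) and k = A + AB + 1, blocks A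
-- and A + AB of the j-fix of length km coincide once A ≥ 16 and B ≥ j + 11A + 11.
module EqualBlocks (j σ Q : ℕ) where
  s = σ * 2
  R = allOnes s
  A = suc R
  B = 2 ^ suc Q
  p = A * 2 + R
  m = B * p + 11
  k = suc (A + A * B)

  A≡2^s : A ≡ 2 ^ s
  A≡2^s = suc-allOnes s

  tm-A-scale : ∀ q y → y < A → tm (A * q + y) ≡ tm q xor tm y
  tm-A-scale q y y<A = subst (λ P → tm (P * q + y) ≡ tm q xor tm y) (sym A≡2^s)
                             (tm-scale s q y (subst (y <_) A≡2^s y<A))

  -- t(p) = t(2) ⊕ t(2^s − 1) = 1, as s is even.
  tm-p : tm p ≡ true
  tm-p = trans (tm-A-scale 2 R ≤-refl) (cong not (tm-allOnes-even σ))

  -- Letters after p: p + 1 + v = 3A + v, and t(3A + v) = t(v) for v < A.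
  tm-after-p : ∀ v → v < A → tm (p + suc v) ≡ tm v
  tm-after-p v v<A = trans (cong tm (position R v)) (tm-A-scale 3 v v<A)
    where
    position : ∀ R v → suc R * 2 + R + suc v ≡ suc R * 3 + v
    position = solve-∀

  module _ (16≤A : 16 ≤ A) (B-large : j + 11 * A + 11 ≤ B) where

    window< : ∀ u → u < 3 → A * 3 + (10 + u) < B
    window< u u<3 = begin-strict
      A * 3 + (10 + u)   <⟨ +-monoʳ-< (A * 3) (+-monoʳ-< 10 u<3) ⟩
      A * 3 + 13         ≤⟨ ≤-slack (A * 3 + 13) (R * 8 + 6) (slack R) ⟩
      11 * A + 11        ≤⟨ +-monoˡ-≤ 11 (m≤n+m (11 * A) j) ⟩
      j + 11 * A + 11    ≤⟨ B-large ⟩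
      B                  ∎
      where
      open ≤-Reasoning
      slack : ∀ R → suc R * 3 + 13 + (R * 8 + 6) ≡ 11 * suc R + 11
      slack = solve-∀

    -- Letters after p + m: p + m + u = B·p + (3A + 10 + u) with 3A + 10 + u < B.
    tm-after-p+m : ∀ u → u < 3 → tm (p + m + u) ≡ not (tm (10 + u))
    tm-after-p+m u u<3 = begin
      tm (p + m + u)                      ≡⟨ cong tm (position R B u) ⟩
      tm (B * p + (A * 3 + (10 + u)))     ≡⟨ tm-scale (suc Q) p (A * 3 + (10 + u)) (window< u u<3) ⟩
      tm p xor tm (A * 3 + (10 + u))      ≡⟨ cong₂ _xor_ tm-p (tm-A-scale 3 (10 + u) 10+u<A) ⟩
      not (tm (10 + u))                   ∎
      where
      open ≡-Reasoning
      position : ∀ R B u → suc R * 2 + R + (B * (suc R * 2 + R) + 11) + u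
                           ≡ B * (suc R * 2 + R) + (suc R * 3 + (10 + u))
      position = solve-∀
      10+u<A : 10 + u < A
      10+u<A = ≤-trans (+-monoʳ-< 10 u<3) (≤-trans (n≤1+n 13) (≤-trans (n≤1+n 14) (≤-trans (n≤1+n 15) 16≤A)))

    -- The seed: factors at p and p + m agree on 3 letters (checked letterwise
    -- against t(10) t(11) t(12) = 0 1 0).
    seed : FactorsAgree p (p + m) 3
    seed zero                _ = trans (cong tm (+-identityʳ p)) (trans tm-p (sym (tm-after-p+m 0 z<s)))
    seed (suc zero)          _ = trans (tm-after-p 0 (≤-trans (s≤s z≤n) 16≤A)) (sym (tm-after-p+m 1 (s≤s (s≤s z≤n))))
    seed (suc (suc zero))    _ = trans (tm-after-p 1 (≤-trans (s≤s (s≤s z≤n)) 16≤A)) (sym (tm-after-p+m 2 ≤-refl))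
    seed (suc (suc (suc _))) (s≤s (s≤s (s≤s ())))

    -- Scaling the seed by 2^(s+Q+1) = AB and reading it at offset j + 11A.
    blocks-agree : FactorsAgree (j + A * m) (j + (A + A * B) * m) m
    blocks-agree = subst₂ (λ x y → FactorsAgree x y m) (left j A B p) (right j A B p)
                     (agree-drop {A * B * p} {A * B * (p + m)} (j + 11 * A) m window scaled)
      where
      2^h≡AB : 2 ^ (s + suc Q) ≡ A * B
      2^h≡AB = trans (^-distribˡ-+-* 2 s (suc Q)) (cong (_* B) (sym A≡2^s))
      scaled : FactorsAgree (A * B * p) (A * B * (p + m)) (3 * (A * B))
      scaled = subst (λ P → FactorsAgree (P * p) (P * (p + m)) (3 * P)) 2^h≡AB
                     (agree-scale (s + suc Q) p (p + m) 3 seed)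
      regroup : ∀ j A B p → j + 11 * A + (B * p + 11) ≡ j + 11 * A + 11 + B * p
      regroup = solve-∀
      three-AB : ∀ R B → B + B * (suc R * 2 + R) ≡ 3 * (suc R * B)
      three-AB = solve-∀
      window : j + 11 * A + m ≤ 3 * (A * B)
      window = ≤-trans (≤-reflexive (regroup j A B p))
                       (≤-trans (+-monoˡ-≤ (B * p) B-large) (≤-reflexive (three-AB R B)))
      left : ∀ j A B p → A * B * p + (j + 11 * A) ≡ j + A * (B * p + 11)
      left = solve-∀
      right : ∀ j A B p → A * B * (p + (B * p + 11)) + (j + 11 * A) ≡ j + (A + A * B) * (B * p + 11)
      right = solve-∀

    m∉F : NotInF j k m
    m∉F = (2 ^ Q * p + 5 , m-odd (2 ^ Q) p) , λ antiPower →
            proj₂ antiPower A (A + A * B) A<k ≤-refl (<⇒≢ (m<m+n A AB>0)) equal-blocks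
      where
      m-odd : ∀ P p → 2 * P * p + 11 ≡ suc ((P * p + 5) * 2)
      m-odd = solve-∀
      A<k : A < k
      A<k = s≤s (m≤m+n A (A * B))
      AB>0 : 0 < A * B
      AB>0 = ≤-trans (m^n>0 2 (suc Q)) (m≤n*m B A)
      equal-blocks : take m (drop (A * m) (jFix j (k * m))) ≡ take m (drop ((A + A * B) * m) (jFix j (k * m)))
      equal-blocks = trans (jFix-block j k m A A<k)
                    (trans (agree⇒factor-≡ (j + A * m) (j + (A + A * B) * m) m blocks-agree) (sym (jFix-block j k m (A + A * B) ≤-refl)))

ratio-bound : ∀ n R B → suc n ≤ R → (2 + 3 * n) * (2 + R) ≤ B →
  (2 + 3 * n) * suc (suc R + suc R * B) < (B * (suc R * 2 + R) + 11) * suc n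
ratio-bound n R B n<R B-large with m≤n⇒∃[o]m+o≡n n<R
... | a , refl with m≤n⇒∃[o]m+o≡n B-large
... | b , refl = subst (lhs <_) (identity n a b) (m<m+n lhs z<s)
  where
  lhs : ℕ
  lhs = (2 + 3 * n) * suc (suc (suc n + a) + suc (suc n + a) * ((2 + 3 * n) * (2 + (suc n + a)) + b))
  -- the two sides with R = n + 1 + a and B = (3n+2)(R+2) + b substituted
  -- differ by a positive polynomial in n, a, b
  identity : ∀ n a b →
    (2 + 3 * n) * suc (suc (suc n + a) + suc (suc n + a) * ((2 + 3 * n) * (2 + (suc n + a)) + b))
      + suc ((2 + 3 * n) * (n + 3 + a) * a + b * (1 + a) + 11 * n + 10)
    ≡ (((2 + 3 * n) * (2 + (suc n + a)) + b) * (suc (suc n + a) * 2 + (suc n + a)) + 11) * suc n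
  identity = solve-∀

-- Upper half of the limsup: Γ_j(k) ≤ 3k − 4 < (3 + 1/(n+1))·k.
gamma-ratio-upper : ∀ j n → ∃[ K ] ((k : ℕ) → k ≥ K → (g : ℕ) → IsGamma j k g → g * suc n < (3 * suc n + 1) * k)
gamma-ratio-upper j n = 3 , λ k 3≤k g (g∉F , _) → begin-strict
  g * suc n          ≤⟨ *-monoˡ-≤ (suc n) (≤-trans (antiPower-bound j k 3≤k g g∉F) (m∸n≤m (3 * k) 4)) ⟩
  3 * k * suc n      <⟨ m<m+n (3 * k * suc n) (≤-trans z<s 3≤k) ⟩
  3 * k * suc n + k  ≡⟨ regroup k (suc n) ⟩
  (3 * suc n + 1) * k ∎
  where
  open ≤-Reasoning
  regroup : ∀ k N → 3 * k * N + k ≡ (3 * N + 1) * k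
  regroup = solve-∀

-- Lower half of the limsup: the construction with σ = n + 8 and Q large
-- exceeds (3 − 1/(n+1))·k beyond any bound K.
gamma-ratio-lower : ∀ j n K → ∃[ k ] (k ≥ K × ∃[ g ] (IsGamma j k g × (3 * suc n ∸ 1) * k < g * suc n))
gamma-ratio-lower j n K = k , K≤k , g , isGamma , ratio
  where
  σ = n + 8
  s = σ * 2
  R = allOnes s
  A = suc R
  X = j + 11 * A + 11
  Y = (2 + 3 * n) * (2 + R)
  Q = K + X + Y
  open EqualBlocks j σ Q using (B; k; m; m∉F)
  s<A : s < A
  s<A = subst (s <_) (sym (suc-allOnes s)) (n<2^n s)
  16≤A : 16 ≤ A
  16≤A = ≤-trans (*-monoˡ-≤ 2 (m≤n+m 8 n)) (<⇒≤ s<A)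
  n<R : suc n ≤ R
  n<R = ≤-trans (≤-slack (suc n) (n + 15) (double n)) (≤-pred s<A)
    where
    double : ∀ n → suc n + (n + 15) ≡ (n + 8) * 2
    double = solve-∀
  Q≤B : Q ≤ B
  Q≤B = <⇒≤ (<-trans (n<1+n Q) (n<2^n (suc Q)))
  X≤B : X ≤ B
  X≤B = ≤-trans (≤-trans (m≤n+m X K) (m≤m+n (K + X) Y)) Q≤B
  Y≤B : Y ≤ B
  Y≤B = ≤-trans (m≤n+m Y (K + X)) Q≤B
  A≤k : A ≤ k
  A≤k = ≤-trans (m≤m+n A (A * B)) (n≤1+n _)
  K≤k : K ≤ k
  K≤k = ≤-trans (≤-trans (m≤m+n K X) (m≤m+n (K + X) Y))
       (≤-trans Q≤B (≤-trans (m≤n*m B A) (≤-trans (m≤n+m (A * B) A) (n≤1+n _))))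
  3≤k : 3 ≤ k
  3≤k = ≤-trans (≤-trans (m≤m+n 3 13) 16≤A) A≤k
  γ : ∃[ g ] (IsGamma j k g × m ≤ g)
  γ = gamma-exists j k 3≤k m (m∉F 16≤A X≤B)
  g = proj₁ γ
  isGamma = proj₁ (proj₂ γ)
  three-suc : ∀ n → 3 * suc n ≡ suc (2 + 3 * n)
  three-suc = solve-∀
  ratio : (3 * suc n ∸ 1) * k < g * suc n
  ratio = begin-strict
    (3 * suc n ∸ 1) * k   ≡⟨ cong (λ c → (c ∸ 1) * k) (three-suc n) ⟩
    (2 + 3 * n) * k       <⟨ ratio-bound n R B n<R Y≤B ⟩
    m * suc n             ≤⟨ *-monoˡ-≤ (suc n) (proj₂ (proj₂ γ)) ⟩
    g * suc n             ∎
    where open ≤-Reasoning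

mainTheorem3 : (j : ℕ) →
    ((k : ℕ) → k ≥ 3 → (m : ℕ) → NotInF j k m → m ≤ 3 * k ∸ 4)
    × ((n : ℕ) → ∃[ K ] ((k : ℕ) → k ≥ K → (g : ℕ) → IsGamma j k g → g * suc n < (3 * suc n + 1) * k))
    × ((n : ℕ) → (K : ℕ) → ∃[ k ] (k ≥ K × ∃[ g ] (IsGamma j k g × (3 * suc n ∸ 1) * k < g * suc n)))
mainTheorem3 j = antiPower-bound j , gamma-ratio-upper j , gamma-ratio-lower j
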